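{- For any nonnegative integer $k$ and any integer $n \ge 4$ with $2k \le n \le 6k+3$, $\Delta(n,k) \le 0$.
   Context: For integers $n \ge 1$ and $k \ge 0$, $JL_{n,k} = \sum_{i=k}^{\lfloor n/2 \rfloor} \frac{n}{n-i} \binom{n-i}{i} \binom{i}{k}$ (empty sum $=0$), and $\Delta(n,k) = JL_{n,k+1} - JL_{n,k}$. -}

module Defs where

import Data.Nat
import Relation.Nullary

open import Data.Nat using (ℕ; zero; suc; _∸_; _≤_) renaming (_*_ to _*ℕ_)
open import Data.Nat.Combinatorics using (_C_)
open import Data.Nat.Base using (⌊_/2⌋)
open import Data.Integer using (+_)
open import Data.Rational using (ℚ; 0ℚ; _+_; _-_; _/_)

-- n / m as a rational; m = 0 never occurs in the uses below
-- (in JL, i ≤ ⌊n/2⌋ and n ≥ 1 give n - i ≥ 1).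
frac : ℕ → ℕ → ℚ
frac a zero    = 0ℚ
frac a (suc d) = (+ a) / suc d

sumFromTo : ℕ → ℕ → (ℕ → ℚ) → ℚ
sumFromTo k m f = go m
  where
  go : ℕ → ℚ
  go zero = step zero
    where step : ℕ → ℚ
          step i with Data.Nat._≤?_ k i
          ... | Relation.Nullary.yes _ = f i
          ... | Relation.Nullary.no _ = 0ℚ
  go (suc j) = go j + stepS
    where stepS : ℚ
          stepS with Data.Nat._≤?_ k (suc j)
          ... | Relation.Nullary.yes _ = f (suc j)
          ... | Relation.Nullary.no _ = 0ℚ

JL : ℕ → ℕ → ℚ
JL n k = sumFromTo k ⌊ n /2⌋ (λ i → frac (n *ℕ ((n ∸ i) C i) *ℕ (i C k)) (n ∸ i))

Δ : ℕ → ℕ → ℚ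
Δ n k = JL n (suc k) - JL n k

-- Write L(n,i) = n/(n-i) C(n-i,i), a natural number, and w_i = L(n,i) C(i,k), so that JL_{n,k} = Σ_i w_i.
-- Since (k+1) C(i,k+1) + k C(i,k) = i C(i,k), the claim JL_{n,k+1} ≤ JL_{n,k} is equivalent to
-- Σ_i i w_i ≤ c Σ_i w_i with c = 2k+1: the w-weighted mean of i is at most c. Pairing i = c + t with c - t,
-- this follows from w_{c+t} ≤ w_{c-t} for all t. For t > k this is trivial, as w_i = 0 once 2i > n and n ≤ 6k+3.
-- For t ≤ k it goes by induction on t: the ratio w_{i+1}/w_i = (n-2i)(n-2i-1)/((n-i-1)(i+1-k)) at i = c + t
-- is at most the inverse of the ratio at i = c - t - 1, a polynomial inequality valid for n ≤ 6k+3.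

module Submission where

open import Defs
open import Data.Nat using (ℕ; _≤_; _*_; _+_)
open import Data.Rational using (0ℚ) renaming (_≤_ to _≤ℚ_)

open import Data.Nat using (zero; suc; _∸_; _<_; _≤?_; z≤n; s≤s; s≤s⁻¹; NonZero; ⌊_/2⌋; ⌈_/2⌉)
open import Data.Nat.Properties
open import Data.Nat.Combinatorics using (_C_; nCk+nC[k+1]≡[n+1]C[k+1]; k>n⇒nCk≡0; nC1≡n)
open import Relation.Binary.PropositionalEquality
open import Relation.Nullary using (yes; no)
open import Function using (_∘_)
open import Data.Product using (_,_; ∃-syntax; proj₂)
open import Data.Sum using (_⊎_; inj₁; inj₂)
open import Data.Nat.Tactic.RingSolver using (solve-∀; solve)
open import Data.List using (_∷_; [])
open import Data.Integer as ℤ using (+≤+)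
import Data.Integer.Properties as ℤ
open import Data.Rational using (ℚ)
import Data.Rational as ℚ
import Data.Rational.Properties as ℚ
open import Data.Rational.Literals using (fromℤ)
import Data.Rational.Unnormalised as ℚᵘ
import Data.Rational.Unnormalised.Properties as ℚᵘ
open import Algebra.Properties.CommutativeSemigroup *-commutativeSemigroup
  using (x∙yz≈y∙xz; x∙yz≈yx∙z; x∙yz≈xz∙y; xy∙z≈xz∙y; xy∙z≈x∙zy; interchange)
import Algebra.Properties.CommutativeSemigroup +-commutativeSemigroup as +-CS

[n+1]C[k+1]*[k+1]≡nCk*[n+1] : ∀ n k → (suc n C suc k) * suc k ≡ (n C k) * suc n
[n+1]C[k+1]*[k+1]≡nCk*[n+1] zero    zero    = refl
[n+1]C[k+1]*[k+1]≡nCk*[n+1] zero    (suc k) = refl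
[n+1]C[k+1]*[k+1]≡nCk*[n+1] (suc n) zero    = begin
  (suc (suc n) C 1) * 1 ≡⟨ *-identityʳ _ ⟩
  suc (suc n) C 1       ≡⟨ nC1≡n (suc (suc n)) ⟩
  suc (suc n)           ≡⟨ *-identityˡ (suc (suc n)) ⟨
  1 * suc (suc n)       ∎
  where open ≡-Reasoning
[n+1]C[k+1]*[k+1]≡nCk*[n+1] (suc n) (suc k) = begin
  (suc (suc n) C suc (suc k)) * suc (suc k) ≡⟨ cong (_* suc (suc k)) (nCk+nC[k+1]≡[n+1]C[k+1] (suc n) (suc k)) ⟨
  (a + b) * suc (suc k)                     ≡⟨ *-distribʳ-+ (suc (suc k)) a b ⟩
  a * suc (suc k) + b * suc (suc k)         ≡⟨ cong (_+ b * suc (suc k)) (*-suc a (suc k)) ⟩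
  a + a * suc k + b * suc (suc k)           ≡⟨ +-assoc a _ _ ⟩
  a + (a * suc k + b * suc (suc k))         ≡⟨ cong (a +_) (cong₂ _+_ ([n+1]C[k+1]*[k+1]≡nCk*[n+1] n k)
                                                                     ([n+1]C[k+1]*[k+1]≡nCk*[n+1] n (suc k))) ⟩
  a + ((n C k) * suc n + (n C suc k) * suc n) ≡⟨ cong (a +_) (*-distribʳ-+ (suc n) (n C k) _) ⟨
  a + (n C k + n C suc k) * suc n           ≡⟨ cong (λ x → a + x * suc n) (nCk+nC[k+1]≡[n+1]C[k+1] n k) ⟩
  a + a * suc n                             ≡⟨ *-suc a (suc n) ⟨
  a * suc (suc n)                           ∎
  where
  open ≡-Reasoning
  a = suc n C suc k
  b = suc n C suc (suc k)

nC[k+1]*[k+1]≡nCk*[n∸k] : ∀ n k → (n C suc k) * suc k ≡ (n C k) * (n ∸ k)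
nC[k+1]*[k+1]≡nCk*[n∸k] zero    k       = sym (trans (cong ((0 C k) *_) (0∸n≡0 k)) (*-zeroʳ (0 C k)))
nC[k+1]*[k+1]≡nCk*[n∸k] (suc n) zero    = trans (*-identityʳ _) (trans (nC1≡n (suc n)) (sym (*-identityˡ (suc n))))
nC[k+1]*[k+1]≡nCk*[n∸k] (suc n) (suc k) = begin
  (suc n C suc (suc k)) * suc (suc k)     ≡⟨ [n+1]C[k+1]*[k+1]≡nCk*[n+1] n (suc k) ⟩
  (n C suc k) * suc n                     ≡⟨ nC[k+1]*[n+1]≡nC[k+1]*[k+1+[n∸k]] ⟩
  (n C suc k) * (suc k + (n ∸ k))         ≡⟨ *-distribˡ-+ (n C suc k) (suc k) (n ∸ k) ⟩
  (n C suc k) * suc k + (n C suc k) * (n ∸ k) ≡⟨ cong (_+ (n C suc k) * (n ∸ k)) (nC[k+1]*[k+1]≡nCk*[n∸k] n k) ⟩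
  (n C k) * (n ∸ k) + (n C suc k) * (n ∸ k)   ≡⟨ *-distribʳ-+ (n ∸ k) (n C k) (n C suc k) ⟨
  (n C k + n C suc k) * (n ∸ k)           ≡⟨ cong (_* (n ∸ k)) (nCk+nC[k+1]≡[n+1]C[k+1] n k) ⟩
  (suc n C suc k) * (n ∸ k)               ∎
  where
  open ≡-Reasoning
  nC[k+1]*[n+1]≡nC[k+1]*[k+1+[n∸k]] : (n C suc k) * suc n ≡ (n C suc k) * (suc k + (n ∸ k))
  nC[k+1]*[n+1]≡nC[k+1]*[k+1+[n∸k]] with k ≤? n
  ... | yes k≤n = cong (λ m → (n C suc k) * suc m) (sym (m+[n∸m]≡n k≤n))
  ... | no  k≰n rewrite k>n⇒nCk≡0 (m<n⇒m<1+n (≰⇒> k≰n)) = refl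

[n+1]Ck*[n+1∸k]≡nCk*[n+1] : ∀ n k → (suc n C k) * (suc n ∸ k) ≡ (n C k) * suc n
[n+1]Ck*[n+1∸k]≡nCk*[n+1] n k = trans (sym (nC[k+1]*[k+1]≡nCk*[n∸k] (suc n) k)) ([n+1]C[k+1]*[k+1]≡nCk*[n+1] n k)

nC[k+1]*[k+1]+nCk*k≡nCk*n : ∀ n k → (n C suc k) * suc k + (n C k) * k ≡ (n C k) * n
nC[k+1]*[k+1]+nCk*k≡nCk*n n k = begin
  (n C suc k) * suc k + (n C k) * k ≡⟨ cong (_+ (n C k) * k) (nC[k+1]*[k+1]≡nCk*[n∸k] n k) ⟩
  (n C k) * (n ∸ k) + (n C k) * k   ≡⟨ *-distribˡ-+ (n C k) (n ∸ k) k ⟨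
  (n C k) * (n ∸ k + k)             ≡⟨ nCk*[n∸k+k]≡nCk*n ⟩
  (n C k) * n                       ∎
  where
  open ≡-Reasoning
  nCk*[n∸k+k]≡nCk*n : (n C k) * (n ∸ k + k) ≡ (n C k) * n
  nCk*[n∸k+k]≡nCk*n with k ≤? n
  ... | yes k≤n = cong ((n C k) *_) (m∸n+n≡m k≤n)
  ... | no  k≰n rewrite k>n⇒nCk≡0 (≰⇒> k≰n) = refl

parity-split : ∀ y → ∃[ r ] (y ≡ 2 * r ⊎ y ≡ 1 + 2 * r)
parity-split zero          = 0 , inj₁ refl
parity-split (suc zero)    = 0 , inj₂ refl
parity-split (suc (suc y)) with parity-split y
... | r , inj₁ refl = suc r , inj₁ (sym (*-suc 2 r))
... | r , inj₂ refl = suc r , inj₂ (cong suc (sym (*-suc 2 r)))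

2*m≤1+2*n⇒m≤n : ∀ {m n} → 2 * m ≤ 1 + 2 * n → m ≤ n
2*m≤1+2*n⇒m≤n {m} {n} 2m≤1+2n = s≤s⁻¹ (*-cancelˡ-< 2 m (suc n) (subst (suc (2 * m) ≤_) (sym (*-suc 2 n)) (s≤s 2m≤1+2n)))

n<[1+⌊n/2⌋]+[1+⌊n/2⌋] : ∀ n → n < suc ⌊ n /2⌋ + suc ⌊ n /2⌋
n<[1+⌊n/2⌋]+[1+⌊n/2⌋] n = s≤s (begin
  n                         ≡⟨ ⌊n/2⌋+⌈n/2⌉≡n n ⟨
  ⌊ n /2⌋ + ⌈ n /2⌉         ≤⟨ +-monoʳ-≤ ⌊ n /2⌋ (⌊n/2⌋-mono (n≤1+n (suc n))) ⟩
  ⌊ n /2⌋ + suc ⌊ n /2⌋     ∎)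
  where open ≤-Reasoning

≤-by-ratios : ∀ {a a′ b b′ p q p′ q′} .{{_ : NonZero p}} .{{_ : NonZero q′}} →
  a′ * p ≡ a * q → b′ * p′ ≡ b * q′ → a ≤ b′ → q * q′ ≤ p * p′ → a′ ≤ b
≤-by-ratios {a} {a′} {b} {b′} {p} {q} {p′} {q′} a′p≡aq b′p′≡bq′ a≤b′ qq′≤pp′ =
  *-cancelʳ-≤ a′ b (p * q′) {{m*n≢0 p q′}} (begin
    a′ * (p * q′)   ≡⟨ *-assoc a′ p q′ ⟨
    (a′ * p) * q′   ≡⟨ cong (_* q′) a′p≡aq ⟩
    (a * q) * q′    ≡⟨ *-assoc a q q′ ⟩
    a * (q * q′)    ≤⟨ *-mono-≤ a≤b′ qq′≤pp′ ⟩
    b′ * (p * p′)   ≡⟨ x∙yz≈xz∙y b′ p p′ ⟩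
    (b′ * p′) * p   ≡⟨ cong (_* p) b′p′≡bq′ ⟩
    (b * q′) * p    ≡⟨ xy∙z≈x∙zy b q′ p ⟩
    b * (p * q′)    ∎)
  where open ≤-Reasoning

∑< : ℕ → (ℕ → ℕ) → ℕ
∑< zero    f = 0
∑< (suc n) f = ∑< n f + f n

syntax ∑< n (λ i → e) = ∑[ i < n ] e

∑<-cong : ∀ n {f g : ℕ → ℕ} → (∀ {i} → i < n → f i ≡ g i) → ∑< n f ≡ ∑< n g
∑<-cong zero    _   = refl
∑<-cong (suc n) f≡g = cong₂ _+_ (∑<-cong n (f≡g ∘ m<n⇒m<1+n)) (f≡g (n<1+n n))

∑<-mono-≤ : ∀ n {f g : ℕ → ℕ} → (∀ {i} → i < n → f i ≤ g i) → ∑< n f ≤ ∑< n g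
∑<-mono-≤ zero    _   = ≤-refl
∑<-mono-≤ (suc n) f≤g = +-mono-≤ (∑<-mono-≤ n (f≤g ∘ m<n⇒m<1+n)) (f≤g (n<1+n n))

∑<-+ : ∀ n (f g : ℕ → ℕ) → ∑[ i < n ] (f i + g i) ≡ ∑< n f + ∑< n g
∑<-+ zero    f g = refl
∑<-+ (suc n) f g = trans (cong (_+ (f n + g n)) (∑<-+ n f g)) (+-CS.interchange (∑< n f) (∑< n g) (f n) (g n))

∑<-*ʳ : ∀ n (f : ℕ → ℕ) c → ∑< n f * c ≡ ∑[ i < n ] (f i * c)
∑<-*ʳ zero    f c = refl
∑<-*ʳ (suc n) f c = trans (*-distribʳ-+ c (∑< n f) (f n)) (cong (_+ f n * c) (∑<-*ʳ n f c))

∑<-split : ∀ m n (f : ℕ → ℕ) → ∑< (m + n) f ≡ ∑< m f + ∑[ i < n ] f (m + i)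
∑<-split m zero    f = trans (cong (λ l → ∑< l f) (+-identityʳ m)) (sym (+-identityʳ (∑< m f)))
∑<-split m (suc n) f = begin
  ∑< (m + suc n) f                                      ≡⟨ cong (λ l → ∑< l f) (+-suc m n) ⟩
  ∑< (m + n) f + f (m + n)                              ≡⟨ cong (_+ f (m + n)) (∑<-split m n f) ⟩
  ∑< m f + ∑[ i < n ] f (m + i) + f (m + n)             ≡⟨ +-assoc (∑< m f) _ _ ⟩
  ∑< m f + ∑[ i < suc n ] f (m + i)                     ∎
  where open ≡-Reasoning

∑<-reverse : ∀ n (f : ℕ → ℕ) → ∑< n f ≡ ∑[ i < n ] f (n ∸ suc i)
∑<-reverse zero    f = refl
∑<-reverse (suc n) f = begin
  ∑< n f + f n                            ≡⟨ cong (_+ f n) (∑<-reverse n f) ⟩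
  ∑[ i < n ] f (n ∸ suc i) + f n          ≡⟨ +-comm _ (f n) ⟩
  f n + ∑[ i < n ] f (n ∸ suc i)          ≡⟨ ∑<-split 1 n (λ i → f (n ∸ i)) ⟨
  ∑[ i < suc n ] f (suc n ∸ suc i)        ∎
  where open ≡-Reasoning

∑<-vanishing-tail : ∀ m d (f : ℕ → ℕ) → (∀ {i} → m ≤ i → f i ≡ 0) → ∑< (m + d) f ≡ ∑< m f
∑<-vanishing-tail m zero    f _   = cong (λ l → ∑< l f) (+-identityʳ m)
∑<-vanishing-tail m (suc d) f f≡0 = begin
  ∑< (m + suc d) f              ≡⟨ cong (λ l → ∑< l f) (+-suc m d) ⟩
  ∑< (m + d) f + f (m + d)      ≡⟨ cong₂ _+_ (∑<-vanishing-tail m d f f≡0) (f≡0 (m≤m+n m d)) ⟩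
  ∑< m f + 0                    ≡⟨ +-identityʳ (∑< m f) ⟩
  ∑< m f                        ∎
  where open ≡-Reasoning

∑<-mirror : ∀ c (f : ℕ → ℕ) → ∑< (suc (c + c)) f ≡ f c + ∑[ t < c ] (f (c ∸ suc t) + f (c + suc t))
∑<-mirror c f = begin
  ∑< (suc (c + c)) f                                              ≡⟨ cong (λ l → ∑< l f) (+-suc c c) ⟨
  ∑< (c + suc c) f                                                ≡⟨ ∑<-split c (suc c) f ⟩
  ∑< c f + ∑[ i < 1 + c ] f (c + i)                               ≡⟨ cong₂ _+_ (∑<-reverse c f) (∑<-split 1 c (λ i → f (c + i))) ⟩
  ∑[ t < c ] f (c ∸ suc t) + (f (c + 0) + ∑[ t < c ] f (c + suc t)) ≡⟨ cong (λ x → ∑[ t < c ] f (c ∸ suc t) + (f x + ∑[ t < c ] f (c + suc t))) (+-identityʳ c) ⟩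
  ∑[ t < c ] f (c ∸ suc t) + (f c + ∑[ t < c ] f (c + suc t))     ≡⟨ +-CS.x∙yz≈y∙xz (∑[ t < c ] f (c ∸ suc t)) (f c) _ ⟩
  f c + (∑[ t < c ] f (c ∸ suc t) + ∑[ t < c ] f (c + suc t))     ≡⟨ cong (f c +_) (∑<-+ c _ _) ⟨
  f c + ∑[ t < c ] (f (c ∸ suc t) + f (c + suc t))                ∎
  where open ≡-Reasoning

mirror-pair-≤ : ∀ {x y c} a s → x ≤ y → a + s ≡ c → y * a + x * (c + s) ≤ y * c + x * c
mirror-pair-≤ {x} {y} a s x≤y refl = begin
  y * a + x * (a + s + s)           ≡⟨ cong (y * a +_) (*-distribˡ-+ x (a + s) s) ⟩
  y * a + (x * (a + s) + x * s)     ≤⟨ +-monoʳ-≤ (y * a) (+-monoʳ-≤ (x * (a + s)) (*-monoˡ-≤ s x≤y)) ⟩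
  y * a + (x * (a + s) + y * s)     ≡⟨ +-CS.x∙yz≈xz∙y (y * a) _ _ ⟩
  y * a + y * s + x * (a + s)       ≡⟨ cong (_+ x * (a + s)) (*-distribˡ-+ y a s) ⟨
  y * (a + s) + x * (a + s)         ∎
  where open ≤-Reasoning

mean≤centre : ∀ c (w : ℕ → ℕ) → (∀ {t} → t ≤ c → w (c + t) ≤ w (c ∸ t)) →
  ∑[ i < suc (c + c) ] (w i * i) ≤ ∑[ i < suc (c + c) ] (w i * c)
mean≤centre c w mirror = begin
  ∑[ i < suc (c + c) ] (w i * i)                                                   ≡⟨ ∑<-mirror c _ ⟩
  w c * c + ∑[ t < c ] (w (c ∸ suc t) * (c ∸ suc t) + w (c + suc t) * (c + suc t)) ≤⟨ +-monoʳ-≤ (w c * c) (∑<-mono-≤ c pair) ⟩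
  w c * c + ∑[ t < c ] (w (c ∸ suc t) * c + w (c + suc t) * c)                     ≡⟨ ∑<-mirror c _ ⟨
  ∑[ i < suc (c + c) ] (w i * c)                                                   ∎
  where
  open ≤-Reasoning
  pair : ∀ {t} → t < c → w (c ∸ suc t) * (c ∸ suc t) + w (c + suc t) * (c + suc t) ≤ w (c ∸ suc t) * c + w (c + suc t) * c
  pair {t} t<c = mirror-pair-≤ (c ∸ suc t) (suc t) (mirror t<c) (m∸n+n≡m t<c)

ℕ→ℚ : ℕ → ℚ
ℕ→ℚ a = fromℤ (ℤ.+ a)

ℕ→ℚ-homo-+ : ∀ a b → ℕ→ℚ (a + b) ≡ ℕ→ℚ a ℚ.+ ℕ→ℚ b
ℕ→ℚ-homo-+ a b = ℚ.toℚᵘ-injective (ℚᵘ.≃-trans (ℚᵘ.*≡* eq) (ℚᵘ.≃-sym (ℚ.toℚᵘ-homo-+ (ℕ→ℚ a) (ℕ→ℚ b))))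
  where
  eq = trans (ℤ.*-identityʳ (ℤ.+ (a + b))) (trans (ℤ.pos-+ a b) (sym (trans (ℤ.*-identityʳ _)
    (cong₂ ℤ._+_ (ℤ.*-identityʳ (ℤ.+ a)) (ℤ.*-identityʳ (ℤ.+ b))))))

ℕ→ℚ-mono-≤ : ∀ {a b} → a ≤ b → ℕ→ℚ a ≤ℚ ℕ→ℚ b
ℕ→ℚ-mono-≤ {a} {b} a≤b = ℚ.*≤* (subst₂ ℤ._≤_ (sym (ℤ.*-identityʳ (ℤ.+ a))) (sym (ℤ.*-identityʳ (ℤ.+ b))) (+≤+ a≤b))

p≤q⇒p-q≤0 : ∀ {p q} → p ≤ℚ q → p ℚ.- q ≤ℚ 0ℚ
p≤q⇒p-q≤0 {p} {q} p≤q = subst (p ℚ.- q ≤ℚ_) (ℚ.+-inverseʳ q) (ℚ.+-monoˡ-≤ (ℚ.- q) p≤q)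

frac-*-cancel : ∀ d x → frac (suc d * x) (suc d) ≡ ℕ→ℚ x
frac-*-cancel d x = ℚ.toℚᵘ-injective (ℚᵘ.≃-trans (ℚ.toℚᵘ-fromℚᵘ (ℚᵘ.mkℚᵘ (ℤ.+ (suc d * x)) d))
  (ℚᵘ.*≡* (trans (ℤ.*-identityʳ (ℤ.+ (suc d * x))) (trans (ℤ.pos-* (suc d) x) (ℤ.*-comm (ℤ.+ suc d) (ℤ.+ x))))))

-- n/(n-i) C(n-i,i) = C(n-i,i) + C(n-i-1,i-1), written without division
lucasCoeff : ℕ → ℕ → ℕ
lucasCoeff n zero    = 1
lucasCoeff n (suc i) = (n ∸ suc i) C suc i + (n ∸ suc (suc i)) C i

lucasCoeff-spec : ∀ {n} i d → n ≡ i + suc d → n * (suc d C i) ≡ suc d * lucasCoeff n i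
lucasCoeff-spec zero    d refl = refl
lucasCoeff-spec (suc i) d refl = begin
  (suc i + suc d) * a     ≡⟨ *-distribʳ-+ a (suc i) (suc d) ⟩
  suc i * a + suc d * a   ≡⟨ +-comm (suc i * a) _ ⟩
  suc d * a + suc i * a   ≡⟨ cong (suc d * a +_) (*-comm (suc i) a) ⟩
  suc d * a + a * suc i   ≡⟨ cong (suc d * a +_) ([n+1]C[k+1]*[k+1]≡nCk*[n+1] d i) ⟩
  suc d * a + b * suc d   ≡⟨ cong (suc d * a +_) (*-comm b (suc d)) ⟩
  suc d * a + suc d * b   ≡⟨ *-distribˡ-+ (suc d) a b ⟨
  suc d * (a + b)         ≡⟨ cong (suc d *_) (cong₂ (λ x y → x C suc i + y C i) n∸[i+1]≡d+1 n∸[i+2]≡d) ⟨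
  suc d * lucasCoeff (suc i + suc d) (suc i) ∎
  where
  open ≡-Reasoning
  a = suc d C suc i
  b = d C i
  n∸[i+1]≡d+1 : suc i + suc d ∸ suc i ≡ suc d
  n∸[i+1]≡d+1 = m+n∸m≡n (suc i) (suc d)
  n∸[i+2]≡d : suc i + suc d ∸ suc (suc i) ≡ d
  n∸[i+2]≡d = trans (cong (_∸ suc i) (+-suc i d)) (m+n∸m≡n i d)

-- 2 ≤ n rules out the junk values lucasCoeff 0 1 = lucasCoeff 1 1 = 1 (where n - i ≤ 0).
lucasCoeff-vanish : ∀ {n} i → 2 ≤ n → n < i + i → lucasCoeff n i ≡ 0
lucasCoeff-vanish zero          _             ()
lucasCoeff-vanish (suc zero)    (s≤s (s≤s _)) (s≤s (s≤s ()))
lucasCoeff-vanish {n} (suc (suc i)) _ n<2i+4 = cong₂ _+_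
  (k>n⇒nCk≡0 (m<n+o⇒m∸n<o n (2 + i) n<2i+4))
  (k>n⇒nCk≡0 (m<n+o⇒m∸n<o n (3 + i) (subst (n <_) (cong (suc ∘ suc) (+-suc i (suc i))) n<2i+4)))

lucasCoeff-ratio : ∀ {n} i y → n ≡ i + suc (suc (i + y)) →
  lucasCoeff n (suc i) * (suc (i + y) * suc i) ≡ lucasCoeff n i * ((2 + y) * (1 + y))
lucasCoeff-ratio {n} i y n≡ = *-cancelˡ-≡ _ _ (suc b) (begin
  suc b * (L′ * (b * suc i))           ≡⟨ cong (suc b *_) (x∙yz≈yx∙z L′ b (suc i)) ⟩
  suc b * ((b * L′) * suc i)           ≡⟨ cong (λ z → suc b * (z * suc i)) (lucasCoeff-spec (suc i) (i + y) (trans n≡ (+-suc i b))) ⟨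
  suc b * ((n * (b C suc i)) * suc i)  ≡⟨ cong (suc b *_) (*-assoc n _ (suc i)) ⟩
  suc b * (n * ((b C suc i) * suc i))  ≡⟨ cong (λ z → suc b * (n * z)) (nC[k+1]*[k+1]≡nCk*[n∸k] b i) ⟩
  suc b * (n * (X * (b ∸ i)))          ≡⟨ cong (λ z → suc b * (n * (X * z))) b∸i≡1+y ⟩
  suc b * (n * (X * suc y))            ≡⟨ x∙yz≈y∙xz (suc b) n _ ⟩
  n * (suc b * (X * suc y))            ≡⟨ cong (n *_) (x∙yz≈yx∙z (suc b) X (suc y)) ⟩
  n * ((X * suc b) * suc y)            ≡⟨ cong (λ z → n * (z * suc y)) ([n+1]Ck*[n+1∸k]≡nCk*[n+1] b i) ⟨
  n * (((suc b C i) * (suc b ∸ i)) * suc y) ≡⟨ cong (λ z → n * (((suc b C i) * z) * suc y)) 1+b∸i≡2+y ⟩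
  n * (((suc b C i) * (2 + y)) * suc y) ≡⟨ cong (n *_) (*-assoc (suc b C i) (2 + y) (suc y)) ⟩
  n * ((suc b C i) * ((2 + y) * suc y)) ≡⟨ *-assoc n (suc b C i) _ ⟨
  (n * (suc b C i)) * ((2 + y) * suc y) ≡⟨ cong (_* ((2 + y) * suc y)) (lucasCoeff-spec i b n≡) ⟩
  (suc b * L) * ((2 + y) * suc y)      ≡⟨ *-assoc (suc b) L _ ⟩
  suc b * (L * ((2 + y) * (1 + y)))    ∎)
  where
  open ≡-Reasoning
  b = suc (i + y)
  L = lucasCoeff n i
  L′ = lucasCoeff n (suc i)
  X = b C i
  b∸i≡1+y : b ∸ i ≡ suc y
  b∸i≡1+y = trans (cong (_∸ i) (sym (+-suc i y))) (m+n∸m≡n i (suc y))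
  1+b∸i≡2+y : suc b ∸ i ≡ 2 + y
  1+b∸i≡2+y = trans (cong (_∸ i) (sym (trans (+-suc i (suc y)) (cong suc (+-suc i y))))) (m+n∸m≡n i (2 + y))

weight : ℕ → ℕ → ℕ → ℕ
weight n k i = lucasCoeff n i * (i C k)

weight-vanish : ∀ {n} k i → 2 ≤ n → n < i + i → weight n k i ≡ 0
weight-vanish k i 2≤n n<2i = cong (_* (i C k)) (lucasCoeff-vanish i 2≤n n<2i)

-- w(i+1)/w(i) = (n-2i)(n-2i-1)/((n-i-1)(i+1-k)), with y = n - 2i - 2, p = n - i - 1, d = i + 1 - k.
weight-ratio : ∀ {n k} i y p d → n ≡ i + suc p → p ≡ suc (i + y) → suc i ≡ k + d →
  weight n k (suc i) * (p * d) ≡ weight n k i * ((2 + y) * (1 + y))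
weight-ratio {n} {k} i y p d n≡ refl 1+i≡k+d = begin
  (L′ * C′) * (p * d)          ≡⟨ interchange L′ C′ p d ⟩
  (L′ * p) * (C′ * d)          ≡⟨ cong ((L′ * p) *_) C-ratio ⟩
  (L′ * p) * (Cᵢ * suc i)      ≡⟨ cong ((L′ * p) *_) (*-comm Cᵢ (suc i)) ⟩
  (L′ * p) * (suc i * Cᵢ)      ≡⟨ *-assoc L′ p _ ⟩
  L′ * (p * (suc i * Cᵢ))      ≡⟨ cong (L′ *_) (*-assoc p (suc i) Cᵢ) ⟨
  L′ * ((p * suc i) * Cᵢ)      ≡⟨ *-assoc L′ _ Cᵢ ⟨
  (L′ * (p * suc i)) * Cᵢ      ≡⟨ cong (_* Cᵢ) (lucasCoeff-ratio i y n≡) ⟩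
  (L * N) * Cᵢ                 ≡⟨ xy∙z≈xz∙y L N Cᵢ ⟩
  (L * Cᵢ) * N                 ∎
  where
  open ≡-Reasoning
  L = lucasCoeff n i
  L′ = lucasCoeff n (suc i)
  Cᵢ = i C k
  C′ = suc i C k
  N = (2 + y) * (1 + y)
  C-ratio : C′ * d ≡ Cᵢ * suc i
  C-ratio = trans (cong (C′ *_) (sym (trans (cong (_∸ k) 1+i≡k+d) (m+n∸m≡n k d)))) ([n+1]Ck*[n+1∸k]≡nCk*[n+1] i k)

weight[k+1]*[k+1]+weight*k≡weight*i : ∀ n k i → weight n (suc k) i * suc k + weight n k i * k ≡ weight n k i * i
weight[k+1]*[k+1]+weight*k≡weight*i n k i = begin
  L * (i C suc k) * suc k + L * (i C k) * k     ≡⟨ cong₂ _+_ (*-assoc L (i C suc k) (suc k)) (*-assoc L (i C k) k) ⟩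
  L * ((i C suc k) * suc k) + L * ((i C k) * k) ≡⟨ *-distribˡ-+ L _ _ ⟨
  L * ((i C suc k) * suc k + (i C k) * k)       ≡⟨ cong (L *_) (nC[k+1]*[k+1]+nCk*k≡nCk*n i k) ⟩
  L * ((i C k) * i)                             ≡⟨ *-assoc L (i C k) i ⟨
  L * (i C k) * i                               ∎
  where
  open ≡-Reasoning
  L = lucasCoeff n i

-- For k = j + e + 1 and n = 8 + 6j + 4e + y, the left factors are the numerators and the right factors the
-- denominators of the weight ratios at i = c + j and at i = c - j - 1 (c = 2k + 1), so this says that
-- the first ratio is at most the inverse of the second.
MirrorRatioBound : ℕ → ℕ → ℕ → Set
MirrorRatioBound j e y =
  (2 + y) * (1 + y) * ((2 + (2 + 4 * j + y)) * (1 + (2 + 4 * j + y))) ≤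
  ((4 + 3 * j + 2 * e + y) * (3 + 2 * j + e)) * ((5 + 5 * j + 2 * e + y) * (2 + e))

-- For y = 2r (resp. 2r + 1) and e = r + s, the difference of the two sides of MirrorRatioBound is a
-- polynomial with nonnegative coefficients.
mirrorRatioBound-even : ∀ r s j → (2 + 2 * r) * (1 + 2 * r) * ((2 + (2 + 4 * j + 2 * r)) * (1 + (2 + 4 * j + 2 * r))) +
  (96 + 234 * j + 198 * j * j + 60 * j * j * j + 208 * s + 383 * s * j + 209 * s * j * j + 30 * s * j * j * j + 134 * s * s + 167 * s * s * j + 47 * s * s * j * j + 38 * s * s * s + 24 * s * s * s * j + 4 * s * s * s * s + 216 * r + 351 * r * j + 177 * r * j * j + 30 * r * j * j * j + 406 * r * s + 482 * r * s * j + 126 * r * s * j * j + 172 * r * s * s + 104 * r * s * s * j + 24 * r * s * s * s + 156 * r * r + 123 * r * r * j + 15 * r * r * j * j + 250 * r * r * s + 144 * r * r * s * j + 52 * r * r * s * s + 36 * r * r * r + 48 * r * r * r * s)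
  ≡ ((4 + 3 * j + 2 * (r + s) + 2 * r) * (3 + 2 * j + (r + s))) * ((5 + 5 * j + 2 * (r + s) + 2 * r) * (2 + (r + s)))
mirrorRatioBound-even = solve-∀

mirrorRatioBound-odd : ∀ r s j → (2 + (1 + 2 * r)) * (1 + (1 + 2 * r)) * ((2 + (2 + 4 * j + (1 + 2 * r))) * (1 + (2 + 4 * j + (1 + 2 * r)))) +
  (60 + 162 * j + 166 * j * j + 60 * j * j * j + 282 * s + 459 * s * j + 225 * s * j * j + 30 * s * j * j * j + 164 * s * s + 183 * s * s * j + 47 * s * s * j * j + 42 * s * s * s + 24 * s * s * s * j + 4 * s * s * s * s + 106 * r + 187 * r * j + 129 * r * j * j + 30 * r * j * j * j + 486 * r * s + 522 * r * s * j + 126 * r * s * j * j + 188 * r * s * s + 104 * r * s * s * j + 24 * r * s * s * s + 62 * r * r + 51 * r * r * j + 15 * r * r * j * j + 270 * r * r * s + 144 * r * r * s * j + 52 * r * r * s * s + 12 * r * r * r + 48 * r * r * r * s)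
  ≡ ((4 + 3 * j + 2 * (r + s) + (1 + 2 * r)) * (3 + 2 * j + (r + s))) * ((5 + 5 * j + 2 * (r + s) + (1 + 2 * r)) * (2 + (r + s)))
mirrorRatioBound-odd = solve-∀

mirrorRatioBound : ∀ j e y → y ≤ 1 + 2 * e → MirrorRatioBound j e y
mirrorRatioBound j e y y≤1+2e with parity-split y
... | r , inj₁ refl = subst (λ e → MirrorRatioBound j e (2 * r))
  (proj₂ (m≤n⇒∃[o]m+o≡n (2*m≤1+2*n⇒m≤n {r} {e} y≤1+2e))) (m+n≤o⇒m≤o _ (≤-reflexive (mirrorRatioBound-even r _ j)))
... | r , inj₂ refl = subst (λ e → MirrorRatioBound j e (1 + 2 * r))
  (proj₂ (m≤n⇒∃[o]m+o≡n (2*m≤1+2*n⇒m≤n {r} {e} (≤-trans (n≤1+n (2 * r)) y≤1+2e)))) (m+n≤o⇒m≤o _ (≤-reflexive (mirrorRatioBound-odd r _ j)))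

weight-mirror-step : ∀ {n k} j e y → suc j + e ≡ k →
  (suc (k + k) + suc j) + (suc (k + k) + suc j) + y ≡ n → n ≤ 6 * k + 3 →
  weight n k (suc (k + k) + j) ≤ weight n k (suc (k + k) ∸ j) →
  weight n k (suc (k + k) + suc j) ≤ weight n k (suc (k + k) ∸ suc j)
weight-mirror-step {n} {k} j e y refl refl n≤6k+3 ih =
  subst₂ (λ a b → weight n k a ≤ weight n k b) (sym (+-suc (suc (k + k)) j)) (sym c∸[1+j]≡i₀)
    (≤-by-ratios ratio₁ ratio₀ ih′ (mirrorRatioBound j e y y≤1+2e))
  where
  ratio₁ : weight n k (suc (suc (k + k) + j)) * ((4 + 3 * j + 2 * e + y) * (3 + 2 * j + e)) ≡
           weight n k (suc (k + k) + j) * ((2 + y) * (1 + y))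
  ratio₁ = weight-ratio {n} {k} (suc (k + k) + j) y (4 + 3 * j + 2 * e + y) (3 + 2 * j + e)
    (solve (j ∷ e ∷ y ∷ [])) (solve (j ∷ e ∷ y ∷ [])) (solve (j ∷ e ∷ []))
  ratio₀ : weight n k (suc (2 + j + 2 * e)) * ((5 + 5 * j + 2 * e + y) * (2 + e)) ≡
           weight n k (2 + j + 2 * e) * ((2 + (2 + 4 * j + y)) * (1 + (2 + 4 * j + y)))
  ratio₀ = weight-ratio {n} {k} (2 + j + 2 * e) (2 + 4 * j + y) (5 + 5 * j + 2 * e + y) (2 + e)
    (solve (j ∷ e ∷ y ∷ [])) (solve (j ∷ e ∷ y ∷ [])) (solve (j ∷ e ∷ []))
  c≡1+j+i₀ : suc (k + k) ≡ suc j + (2 + j + 2 * e)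
  c≡1+j+i₀ = solve (j ∷ e ∷ [])
  c∸[1+j]≡i₀ : suc (k + k) ∸ suc j ≡ 2 + j + 2 * e
  c∸[1+j]≡i₀ = trans (cong (_∸ suc j) c≡1+j+i₀) (m+n∸m≡n (suc j) (2 + j + 2 * e))
  c∸j≡1+i₀ : suc (k + k) ∸ j ≡ suc (2 + j + 2 * e)
  c∸j≡1+i₀ = trans (cong (_∸ j) (trans c≡1+j+i₀ (sym (+-suc j _)))) (m+n∸m≡n j (suc (2 + j + 2 * e)))
  ih′ : weight n k (suc (k + k) + j) ≤ weight n k (suc (2 + j + 2 * e))
  ih′ = subst (λ b → weight n k (suc (k + k) + j) ≤ weight n k b) c∸j≡1+i₀ ih
  n≡ : n ≡ 8 + 6 * j + 4 * e + y
  n≡ = solve (j ∷ e ∷ y ∷ [])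
  6k+3≡ : 6 * k + 3 ≡ 8 + 6 * j + 4 * e + (1 + 2 * e)
  6k+3≡ = solve (j ∷ e ∷ [])
  y≤1+2e : y ≤ 1 + 2 * e
  y≤1+2e = +-cancelˡ-≤ (8 + 6 * j + 4 * e) y (1 + 2 * e) (subst₂ _≤_ n≡ 6k+3≡ n≤6k+3)

weight-mirror-≤k : ∀ {n k} j → 2 ≤ n → n ≤ 6 * k + 3 → j ≤ k →
  weight n k (suc (k + k) + j) ≤ weight n k (suc (k + k) ∸ j)
weight-mirror-≤k {n} {k} zero    _   _       _   = ≤-reflexive (cong (weight n k) (+-identityʳ (suc (k + k))))
weight-mirror-≤k {n} {k} (suc j) 2≤n n≤6k+3 j<k with (suc (k + k) + suc j) + (suc (k + k) + suc j) ≤? n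
... | no  2i≰n = ≤-trans (≤-reflexive (weight-vanish k (suc (k + k) + suc j) 2≤n (≰⇒> 2i≰n))) z≤n
... | yes 2i≤n = weight-mirror-step j _ _ (proj₂ (m≤n⇒∃[o]m+o≡n j<k)) (proj₂ (m≤n⇒∃[o]m+o≡n 2i≤n)) n≤6k+3
  (weight-mirror-≤k j 2≤n n≤6k+3 (<⇒≤ j<k))

weight-mirror : ∀ {n k} t → 2 ≤ n → n ≤ 6 * k + 3 →
  weight n k (suc (k + k) + t) ≤ weight n k (suc (k + k) ∸ t)
weight-mirror {n} {k} t 2≤n n≤6k+3 with t ≤? k
... | yes t≤k = weight-mirror-≤k t 2≤n n≤6k+3 t≤k
... | no  t≰k = ≤-trans (≤-reflexive (weight-vanish k (c + t) 2≤n n<2[c+t])) z≤n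
  where
  c = suc (k + k)
  6k+4≡ : suc (6 * k + 3) ≡ (suc (k + k) + suc k) + (suc (k + k) + suc k)
  6k+4≡ = solve (k ∷ [])
  n<2[c+t] : n < (c + t) + (c + t)
  n<2[c+t] = ≤-trans (s≤s n≤6k+3) (≤-trans (≤-reflexive 6k+4≡) (+-mono-≤ c+k<c+t c+k<c+t))
    where c+k<c+t = +-monoʳ-≤ c (≰⇒> t≰k)

∑weight-succ≤∑weight : ∀ {n k} → 2 ≤ n → n ≤ 6 * k + 3 →
  ∑[ i < suc ⌊ n /2⌋ ] weight n (suc k) i ≤ ∑[ i < suc ⌊ n /2⌋ ] weight n k i
∑weight-succ≤∑weight {n} {k} 2≤n n≤6k+3 = begin
  ∑< h W′      ≡⟨ extend (suc k) ⟩
  ∑< N W′      ≤⟨ *-cancelʳ-≤ (∑< N W′) (∑< N W) (suc k) centred ⟩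
  ∑< N W       ≡⟨ extend k ⟨
  ∑< h W       ∎
  where
  open ≤-Reasoning
  h = suc ⌊ n /2⌋
  c = suc (k + k)
  N = suc (c + c)
  W = weight n k
  W′ = weight n (suc k)
  beyond-h : ∀ {i} → h ≤ i → n < i + i
  beyond-h h≤i = ≤-trans (n<[1+⌊n/2⌋]+[1+⌊n/2⌋] n) (+-mono-≤ h≤i h≤i)
  6k+4≤2N : suc (6 * k + 3) ≤ suc (suc (k + k) + suc (k + k)) + suc (suc (k + k) + suc (k + k))
  6k+4≤2N = m+n≤o⇒m≤o (suc (6 * k + 3)) {2 + 2 * k} (≤-reflexive (solve (k ∷ [])))
  beyond-N : ∀ {i} → N ≤ i → n < i + i
  beyond-N N≤i = ≤-trans (s≤s n≤6k+3) (≤-trans 6k+4≤2N (+-mono-≤ N≤i N≤i))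
  extend : ∀ k′ → ∑< h (weight n k′) ≡ ∑< N (weight n k′)
  extend k′ = begin-equality
    ∑< h (weight n k′)        ≡⟨ ∑<-vanishing-tail h N _ (λ {i} h≤i → weight-vanish k′ i 2≤n (beyond-h h≤i)) ⟨
    ∑< (h + N) (weight n k′)  ≡⟨ cong (λ l → ∑< l (weight n k′)) (+-comm h N) ⟩
    ∑< (N + h) (weight n k′)  ≡⟨ ∑<-vanishing-tail N h _ (λ {i} N≤i → weight-vanish k′ i 2≤n (beyond-N N≤i)) ⟩
    ∑< N (weight n k′)        ∎
  centred : ∑< N W′ * suc k ≤ ∑< N W * suc k
  centred = +-cancelʳ-≤ (∑[ i < N ] (W i * k)) _ _ (begin
    ∑< N W′ * suc k + ∑[ i < N ] (W i * k)            ≡⟨ cong (_+ ∑[ i < N ] (W i * k)) (∑<-*ʳ N W′ (suc k)) ⟩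
    ∑[ i < N ] (W′ i * suc k) + ∑[ i < N ] (W i * k)  ≡⟨ ∑<-+ N _ _ ⟨
    ∑[ i < N ] (W′ i * suc k + W i * k)               ≡⟨ ∑<-cong N (λ {i} _ → weight[k+1]*[k+1]+weight*k≡weight*i n k i) ⟩
    ∑[ i < N ] (W i * i)                              ≤⟨ mean≤centre c W (λ {t} _ → weight-mirror {n} {k} t 2≤n n≤6k+3) ⟩
    ∑[ i < N ] (W i * c)                              ≡⟨ ∑<-cong N (λ {i} _ → *-distribˡ-+ (W i) (suc k) k) ⟩
    ∑[ i < N ] (W i * suc k + W i * k)                ≡⟨ ∑<-+ N _ _ ⟩
    ∑[ i < N ] (W i * suc k) + ∑[ i < N ] (W i * k)   ≡⟨ cong (_+ ∑[ i < N ] (W i * k)) (∑<-*ʳ N W (suc k)) ⟨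
    ∑< N W * suc k + ∑[ i < N ] (W i * k)             ∎)

sumFromTo≡∑< : ∀ k m {f : ℕ → ℚ} {g : ℕ → ℕ} → (∀ {i} → k ≤ i → i ≤ m → f i ≡ ℕ→ℚ (g i)) →
  (∀ {i} → i < k → g i ≡ 0) → sumFromTo k m f ≡ ℕ→ℚ (∑[ i < suc m ] g i)
sumFromTo≡∑< k zero    f≡g g≡0 with k ≤? 0
... | yes k≤0 = f≡g k≤0 ≤-refl
... | no  k≰0 = cong ℕ→ℚ (sym (g≡0 (≰⇒> k≰0)))
sumFromTo≡∑< k (suc m) {g = g} f≡g g≡0
  with k ≤? suc m | sumFromTo≡∑< k m (λ k≤i i≤m → f≡g k≤i (m≤n⇒m≤1+n i≤m)) g≡0
... | yes k≤m+1 | upTo-m = trans (cong₂ ℚ._+_ upTo-m (f≡g k≤m+1 ≤-refl)) (sym (ℕ→ℚ-homo-+ _ (g (suc m))))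
... | no  k≰m+1 | upTo-m = trans (cong₂ ℚ._+_ upTo-m (cong ℕ→ℚ (sym (g≡0 (≰⇒> k≰m+1))))) (sym (ℕ→ℚ-homo-+ _ (g (suc m))))

JL-term≡weight : ∀ {n} k i → i < n → frac (n * ((n ∸ i) C i) * (i C k)) (n ∸ i) ≡ ℕ→ℚ (weight n k i)
JL-term≡weight {n} k i i<n with m≤n⇒∃[o]m+o≡n i<n
... | d , refl = begin
  frac (n * ((n ∸ i) C i) * (i C k)) (n ∸ i)  ≡⟨ cong (λ m → frac (n * (m C i) * (i C k)) m) n∸i≡1+d ⟩
  frac (n * (suc d C i) * (i C k)) (suc d)    ≡⟨ cong (λ a → frac (a * (i C k)) (suc d)) (lucasCoeff-spec i d (sym (+-suc i d))) ⟩
  frac (suc d * lucasCoeff n i * (i C k)) (suc d) ≡⟨ cong (λ a → frac a (suc d)) (*-assoc (suc d) (lucasCoeff n i) (i C k)) ⟩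
  frac (suc d * weight n k i) (suc d)         ≡⟨ frac-*-cancel d (weight n k i) ⟩
  ℕ→ℚ (weight n k i)                          ∎
  where
  open ≡-Reasoning
  n∸i≡1+d : suc i + d ∸ i ≡ suc d
  n∸i≡1+d = trans (cong (_∸ i) (sym (+-suc i d))) (m+n∸m≡n i (suc d))

JL≡∑weight : ∀ {n} k → 1 ≤ n → JL n k ≡ ℕ→ℚ (∑[ i < suc ⌊ n /2⌋ ] weight n k i)
JL≡∑weight {suc n} k _ = sumFromTo≡∑< k ⌊ suc n /2⌋
  (λ _ i≤h → JL-term≡weight k _ (≤-<-trans i≤h (⌊n/2⌋<n n)))
  (λ {i} i<k → trans (cong (lucasCoeff (suc n) i *_) (k>n⇒nCk≡0 i<k)) (*-zeroʳ (lucasCoeff (suc n) i)))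

proposition3p6 : (k n : ℕ) → 4 ≤ n → 2 * k ≤ n → n ≤ 6 * k + 3 → Δ n k ≤ℚ 0ℚ
proposition3p6 k n 4≤n _ n≤6k+3 =
  subst (_≤ℚ 0ℚ) (sym (cong₂ ℚ._-_ (JL≡∑weight (suc k) 1≤n) (JL≡∑weight k 1≤n)))
    (p≤q⇒p-q≤0 (ℕ→ℚ-mono-≤ (∑weight-succ≤∑weight 2≤n n≤6k+3)))
  where
  1≤n = ≤-trans (s≤s z≤n) 4≤n
  2≤n = ≤-trans (s≤s (s≤s z≤n)) 4≤n
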